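{- For all signed permutations $(\omega,\epsilon)\in B_n$, the image $\gamma(\rho_{R_{\omega,\epsilon}})$ is the fundamental cycle (up to sign) of the order complex of $\overline\Pi_{\omega,\epsilon}$, the proper part of $\Pi_{\omega,\epsilon}$.
   Context: $\mathcal{B}_n$ is the arrangement in $\mathbb{R}^n$ of hyperplanes $x_i=x_j$, $x_i=-x_j$ ($1\le i<j\le n$) and $x_i=0$ ($1\le i\le n$), with intersection lattice $L_{\mathcal{B}_n}$ (ordered by reverse inclusion). $B_n$ is the set of pairs $(\omega,\epsilon)$, $\omega\in S_n$, $\epsilon\in\{ -1,1\}^n$, written as words where $\omega(i)$ is barred iff $\epsilon_i=-1$. Region: $R_{\omega,\epsilon}=\{\mathbf x:0<\epsilon_1x_{\omega(1)}<\dots<\epsilon_nx_{\omega(n)}\}$. For a region $R$, $\rho_R$ is the fundamental cycle (up to sign) of the $(n-2)$-sphere given by the order complex of the proper part of the subposet of $L_{\mathcal{B}_n}$ consisting of the linear spans of the nonempty faces of $\mathrm{cl}(R)$. Signed partitions: partitions of $\{0,1,\dots,n\}$ in which nonminimal elements of blocks not containing $0$ (nonzero blocks) may be barred; the block containing $0$ (zero block) has no bars. A barred letter $\bar a$ is also written $(a,-1)$, unbarred $(a,1)$. For a block $b$, $\bar b$ toggles the bar on every element and $\widetilde b$ removes all bars. $\Pi^B_n$ is the poset of signed partitions with $\pi\le\tau$ iff for each block $b$ of $\pi$, either $b$ or $\bar b$ is contained (as a set of signed letters) in a nonzero block of $\tau$, or $\widetilde b$ is contained in the zero block of $\tau$.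 For $\pi\in\Pi^B_n$, $\ell_\pi$ is the set of $\mathbf x\in\mathbb{R}^n$ with $x_i=x_j$ when $i,j$ are in the same block with equal bar status, $x_i=-x_j$ when in the same block with different bar status, and $x_i=0$ for $i$ in the zero block; $\pi\mapsto\ell_\pi$ is an isomorphism $\Pi^B_n\to L_{\mathcal{B}_n}$ and $\gamma$ is its inverse. Splitting: to split $(\omega,\epsilon)$ at positions $i_1<\dots<i_k$ in $\{0,1,\dots,n-1\}$ (put $i_{k+1}=n$; if $k=0$ the result is the one-block partition $\{0,1,\dots,n\}$) form the signed partition with zero block $b_0=\{0,\omega(1),\dots,\omega(i_1)\}$ (unbarred) and, for $j=1,\dots,k$, the nonzero block equal to whichever of $b_j=\{(\omega(i_j+1),\epsilon_{i_j+1}),\dots,(\omega(i_{j+1}),\epsilon_{i_{j+1}})\}$ or $\bar b_j$ has its minimal element unbarred. $\Pi_{\omega,\epsilon}$ is the induced subposet of $\Pi^B_n$ of all signed partitions obtained by splitting $(\omega,\epsilon)$; it is isomorphic to the Boolean lattice of subsets of $[n]$, so its proper part has order complex an $(n-2)$-sphere.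
   Formalization: The ambient space is ℚ^n instead of ℝ^n, so the region $R_{\omega,\epsilon}$, the faces of its closure, their linear spans and the subspaces $\ell_\pi$ consist of points with rational coordinates. -}

module Defs where

open import Data.Nat using (ℕ)
open import Data.Fin using (Fin; zero; suc; inject₁; toℕ; _<?_)
open import Data.Fin.Permutation using (Permutation′; _⟨$⟩ʳ_)
open import Data.Fin.Subset using (Subset; _∈_)
open import Data.Sign using (Sign; opposite) renaming (+ to ⊕; - to ⊖)
import Data.Rational
open import Data.Rational using (ℚ; 0ℚ; _≤_; _+_; _*_; -_)
open import Data.List using (List; []; _∷_; map; foldr)
open import Data.List.Relation.Unary.All using (All)
open import Data.List.Membership.Propositional renaming (_∈_ to _∈ₗ_)
import Data.Vec
import Data.Nat
open import Data.Bool using (Bool; true; false; if_then_else_)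
open import Data.Product using (_×_; _,_; proj₁; proj₂; ∃)
open import Relation.Nullary.Decidable using (does)
open import Relation.Binary.PropositionalEquality using (_≡_)

-- Signed permutations (ω , ε) ∈ B_n.  Positions are 0-indexed Fin n:
-- position p of the word carries the letter ω(p+1) with sign ε_{p+1}.

record SignedPerm (n : ℕ) : Set where
  field
    ω : Permutation′ n
    ε : Fin n → Sign
open SignedPerm public

Point : ℕ → Set
Point n = Fin n → ℚ

_·_ : Sign → ℚ → ℚ
⊕ · q = q
⊖ · q = - q

-- The region R_{ω,ε} = {x : 0 < ε₁x_{ω(1)} < … < εₙx_{ω(n)}} and its
-- closure cl(R) = {x : 0 ≤ ε₁x_{ω(1)} ≤ … ≤ εₙx_{ω(n)}}.

val : ∀ {n} → SignedPerm n → Point n → Fin n → ℚ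
val w x p = ε w p · x (ω w ⟨$⟩ʳ p)

prev : ∀ {n} → SignedPerm n → Point n → Fin n → ℚ
prev w x zero    = 0ℚ
prev w x (suc p) = val w x (inject₁ p)

Region : ∀ {n} → SignedPerm n → Point n → Set
Region w x = ∀ p → Data.Rational._<_ (prev w x p) (val w x p)

Closure : ∀ {n} → SignedPerm n → Point n → Set
Closure w x = ∀ p → prev w x p ≤ val w x p

-- The faces of the polyhedral cone cl(R): those obtained by making a
-- subset T of the n defining inequalities tight.  (Each contains 0, so
-- all are nonempty.)
Face : ∀ {n} → SignedPerm n → Subset n → Point n → Set
Face w T x = Closure w x × (∀ p → p ∈ T → prev w x p ≡ val w x p)

sumℚ : List ℚ → ℚ
sumℚ = foldr _+_ 0ℚ

Span : ∀ {n} → (Point n → Set) → Point n → Set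
Span {n} F x = ∃ λ (cs : List (ℚ × Point n)) →
  All (λ c → F (proj₂ c)) cs ×
  (∀ i → x i ≡ sumℚ (map (λ c → proj₁ c * proj₂ c i) cs))

SameSpace : ∀ {n} → (Point n → Set) → (Point n → Set) → Set
SameSpace {n} A B = ∀ (x : Point n) → (A x → B x) × (B x → A x)

-- Signed partitions of {0,1,…,n}.  The element 0 is implicit in the zero
-- block; the letter i ∈ [n] is represented by Fin n (i ↦ i-1).
-- A signed letter is (a , s) with s = ⊖ meaning barred.

Letter : ℕ → Set
Letter n = Fin n × Sign

record SignedPartition (n : ℕ) : Set where
  field
    zeroBlock : List (Fin n)
    blocks    : List (List (Letter n))
open SignedPartition public

ℓ : ∀ {n} → SignedPartition n → Point n → Set
ℓ π x =
  (∀ i → i ∈ₗ zeroBlock π → x i ≡ 0ℚ) ×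
  (∀ b → b ∈ₗ blocks π → ∀ i s j t → (i , s) ∈ₗ b → (j , t) ∈ₗ b →
      s · x i ≡ t · x j)

minLetter : ∀ {n} → Letter n → List (Letter n) → Letter n
minLetter m [] = m
minLetter m (a ∷ r) =
  minLetter (if does (toℕ (proj₁ a) Data.Nat.<? toℕ (proj₁ m)) then a else m) r

flipBlock : ∀ {n} → List (Letter n) → List (Letter n)
flipBlock = map (λ a → proj₁ a , opposite (proj₂ a))

-- choose b or b̄, whichever has its minimal element unbarred
normalise : ∀ {n} → List (Letter n) → List (Letter n)
normalise [] = []
normalise (a ∷ r) with proj₂ (minLetter a r)
... | ⊕ = a ∷ r
... | ⊖ = flipBlock (a ∷ r)

segments : ∀ {n} → List (Letter n × Bool) → List (Letter n) × List (List (Letter n))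
segments [] = [] , []
segments ((a , false) ∷ r) = (a ∷ proj₁ (segments r)) , proj₂ (segments r)
segments ((a , true)  ∷ r) = [] , ((a ∷ proj₁ (segments r)) ∷ proj₂ (segments r))

allFinL : ∀ n → List (Fin n)
allFinL ℕ.zero = []
allFinL (ℕ.suc n) = zero ∷ map suc (allFinL n)

-- The split of (ω , ε) at the set S ⊆ {0,…,n-1} of positions: position
-- i ∈ S (a Fin n value) means a cut after the first i letters, i.e.
-- before the letter at 0-indexed position i.
split : ∀ {n} → SignedPerm n → Subset n → SignedPartition n
split {n} w S = record
  { zeroBlock = map proj₁ (proj₁ segs)
  ; blocks    = map normalise (proj₂ segs) }
  where
  word : List (Letter n × Bool)
  word = map (λ p → ((ω w ⟨$⟩ʳ p) , ε w p) , Data.Vec.lookup S p)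
             (allFinL n)
  segs = segments word

-- In the coordinates u p = ε_p x_{ω(p)} the closed region is the cone 0 ≤ u₀ ≤ u₁ ≤ ⋯ ≤ u_{n-1}.
-- Every u telescopes as u p = Σ_{q ≤ p} (u q - u (q-1)) with u (-1) = 0, so the face on which
-- the inequalities indexed by T are tight is spanned by the rays [q ≤ ·] with q ∉ T, and its
-- span is the subspace on which exactly those inequalities hold with equality.  An equality
-- u (p-1) = u p glues the letter at position p to its predecessor (to the zero block when
-- p = 0), so this subspace is ℓ of the split of (ω , ε) at the positions outside T.
-- Hence S = ∁ T, in both directions.

{-# OPTIONS --safe #-}
module Submission where

open import Defs
open import Data.Nat using (ℕ)
open import Data.Fin.Subset using (Subset)
open import Data.Product using (_×_; ∃)

open import Data.Bool using (Bool; true; false)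
open import Data.Bool.Properties using (¬-not)
open import Data.Empty using (⊥-elim)
open import Data.Fin using (Fin; zero; suc; inject₁)
open import Data.Fin.Permutation using (_⟨$⟩ʳ_; _⟨$⟩ˡ_; inverseˡ; inverseʳ)
open import Data.Fin.Subset using (_∈_; _∉_; ∁)
open import Data.Fin.Subset.Properties
  using (_∈?_; x∈p⇒x∉∁p; x∉∁p⇒x∈p; x∈∁p⇒x∉p; x∉p⇒x∈∁p)
open import Data.List using (List; []; _∷_; map)
open import Data.List.Membership.Propositional using () renaming (_∈_ to _∈ₗ_)
open import Data.List.Membership.Propositional.Properties using (∈-map⁻)
open import Data.List.Properties using (map-∘; map-cong; map-cong-local)
open import Data.List.Relation.Unary.All as All using (All; []; _∷_)
import Data.List.Relation.Unary.All.Properties as All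
open import Data.List.Relation.Unary.Any using (here; there)
open import Data.Product using (_,_; proj₁; proj₂)
open import Data.Product.Function.NonDependent.Propositional using (_×-⇔_)
open import Data.Rational using (ℚ; 0ℚ; 1ℚ; _≤_; _+_; _*_; -_; _-_)
import Data.Rational.Properties as ℚ
open import Data.Rational.Solver using (module +-*-Solver)
open import Algebra.Properties.Group ℚ.+-0-group using (⁻¹-involutive)
open import Data.Sign using (opposite) renaming (+ to ⊕; - to ⊖)
open import Data.Sign.Properties using (opposite-involutive)
open import Data.Unit using (⊤; tt)
import Data.Vec as Vec
open import Data.Vec.Properties using ([]=⇒lookup; lookup⇒[]=)
open import Function using (_∘_)
open import Function.Bundles using (_⇔_; mk⇔; Equivalence)
open import Function.Construct.Identity using (⇔-id)
open import Function.Construct.Symmetry using (⇔-sym)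
open import Function.Properties.Equivalence using () renaming (trans to ⇔-trans)
open import Relation.Nullary using (yes; no; contradiction)
open import Relation.Binary.PropositionalEquality
open ≡-Reasoning

open Equivalence using (to; from)

·-involutive : ∀ s q → s · (s · q) ≡ q
·-involutive ⊕ q = refl
·-involutive ⊖ q = ⁻¹-involutive q

opposite-· : ∀ s q → opposite s · q ≡ - (s · q)
opposite-· ⊕ q = refl
opposite-· ⊖ q = sym (⁻¹-involutive q)

·-zero : ∀ s → s · 0ℚ ≡ 0ℚ
·-zero ⊕ = refl
·-zero ⊖ = refl

·≡0⇔≡0 : ∀ s q → s · q ≡ 0ℚ ⇔ q ≡ 0ℚ
·≡0⇔≡0 s q = mk⇔
  (λ e → trans (sym (·-involutive s q)) (trans (cong (s ·_) e) (·-zero s)))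
  (λ { refl → ·-zero s })

module _ {A : Set} where

  sumℚ-· : ∀ s (f g : A → ℚ) L →
    s · sumℚ (map (λ c → f c * g c) L) ≡ sumℚ (map (λ c → f c * (s · g c)) L)
  sumℚ-· ⊕ f g L = refl
  sumℚ-· ⊖ f g [] = refl
  sumℚ-· ⊖ f g (c ∷ L) = trans (ℚ.neg-distrib-+ (f c * g c) _)
    (cong₂ _+_ (ℚ.neg-distribʳ-* (f c) (g c)) (sumℚ-· ⊖ f g L))

  sumℚ-*0 : ∀ (f : A → ℚ) L → sumℚ (map (λ c → f c * 0ℚ) L) ≡ 0ℚ
  sumℚ-*0 f [] = refl
  sumℚ-*0 f (c ∷ L) = cong₂ _+_ (ℚ.*-zeroʳ (f c)) (sumℚ-*0 f L)

∑ : ∀ {n} → (Fin n → ℚ) → ℚ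
∑ {n} f = sumℚ (map f (allFinL n))

∑-suc : ∀ {n} (f : Fin (ℕ.suc n) → ℚ) → ∑ f ≡ f zero + ∑ (f ∘ suc)
∑-suc {n} f = cong (λ L → f zero + sumℚ L) (sym (map-∘ (allFinL n)))

∑-cong : ∀ {n} {f g : Fin n → ℚ} → (∀ q → f q ≡ g q) → ∑ f ≡ ∑ g
∑-cong {n} f≗g = cong sumℚ (map-cong f≗g (allFinL n))

All-cong : ∀ {A : Set} {P Q : A → Set} → (∀ a → P a ⇔ Q a) → ∀ {L} → All P L ⇔ All Q L
All-cong P⇔Q = mk⇔ (All.map (to (P⇔Q _))) (All.map (from (P⇔Q _)))

∀∈-map⇔All : ∀ {A B : Set} (P : B → Set) (f : A → B) L → (∀ b → b ∈ₗ map f L → P b) ⇔ All (P ∘ f) L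
∀∈-map⇔All P f L = mk⇔ (λ H → All.map⁻ (All.tabulate (H _))) (λ H _ → All.lookup (All.map⁺ H))

lookup≡false⇔∉ : ∀ {n} (S : Subset n) p → Vec.lookup S p ≡ false ⇔ p ∉ S
lookup≡false⇔∉ S p = mk⇔
  (λ uncut p∈S → contradiction (trans (sym ([]=⇒lookup p∈S)) uncut) λ ())
  (λ p∉S → ¬-not (p∉S ∘ lookup⇒[]= p S))

-- Telescoping over the rays of the monotone cone

shift : ∀ {n} → ℚ → (Fin n → ℚ) → Fin n → ℚ
shift c u zero    = c
shift c u (suc p) = u (inject₁ p)

shift-suc : ∀ {n} c (u : Fin (ℕ.suc n) → ℚ) (p : Fin n) →
  shift (u zero) (u ∘ suc) p ≡ shift c u (suc p)
shift-suc c u zero    = refl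
shift-suc c u (suc p) = refl

shift-const : ∀ {n} c (p : Fin n) → shift c (λ _ → c) p ≡ c
shift-const c zero    = refl
shift-const c (suc p) = refl

Δ : ∀ {n} → ℚ → (Fin n → ℚ) → Fin n → ℚ
Δ c u q = u q - shift c u q

Δ-suc : ∀ {n} c (u : Fin (ℕ.suc n) → ℚ) (q : Fin n) → Δ (u zero) (u ∘ suc) q ≡ Δ c u (suc q)
Δ-suc c u q = cong (λ t → u (suc q) - t) (shift-suc c u q)

ray : ∀ {n} → Fin n → Fin n → ℚ
ray zero    p       = 1ℚ
ray (suc q) zero    = 0ℚ
ray (suc q) (suc p) = ray q p

0≤ray : ∀ {n} (q p : Fin n) → 0ℚ ≤ ray q p
0≤ray zero    p       = ℚ.nonNegative⁻¹ 1ℚ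
0≤ray (suc q) zero    = ℚ.≤-refl
0≤ray (suc q) (suc p) = 0≤ray q p

ray-monotone : ∀ {n} (q : Fin (ℕ.suc n)) (p : Fin n) → ray q (inject₁ p) ≤ ray q (suc p)
ray-monotone zero    p       = ℚ.≤-refl
ray-monotone (suc q) zero    = 0≤ray q zero
ray-monotone (suc q) (suc p) = ray-monotone q p

ray-steady : ∀ {n} (q : Fin (ℕ.suc n)) (p : Fin n) → suc p ≢ q → ray q (inject₁ p) ≡ ray q (suc p)
ray-steady zero          p       _   = refl
ray-steady (suc zero)    zero    p≢q = ⊥-elim (p≢q refl)
ray-steady (suc (suc q)) zero    _   = refl
ray-steady (suc q)       (suc p) p≢q = ray-steady q p (p≢q ∘ cong suc)

shift-ray-≤ : ∀ {n} (q p : Fin n) → shift 0ℚ (ray q) p ≤ ray q p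
shift-ray-≤ q zero          = 0≤ray q zero
shift-ray-≤ {ℕ.suc _} q (suc p) = ray-monotone q p

shift-ray-≡ : ∀ {n} (q p : Fin n) → p ≢ q → shift 0ℚ (ray q) p ≡ ray q p
shift-ray-≡ zero    zero    p≢q = ⊥-elim (p≢q refl)
shift-ray-≡ (suc q) zero    _   = refl
shift-ray-≡ {ℕ.suc _} q (suc p) p≢q = ray-steady q p p≢q

c+[a-c]*1+s≡a+s : ∀ c a s → c + ((a - c) * 1ℚ + s) ≡ a + s
c+[a-c]*1+s≡a+s = solve 3 (λ c a s → c :+ ((a :- c) :* con 1ℚ :+ s) := a :+ s) refl
  where open +-*-Solver

telescope : ∀ {n} c (u : Fin n → ℚ) p → u p ≡ c + ∑ (λ q → Δ c u q * ray q p)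
telescope {ℕ.suc n} c u zero = begin
  u zero                                 ≡⟨ ℚ.+-identityʳ (u zero) ⟨
  u zero + 0ℚ                            ≡⟨ c+[a-c]*1+s≡a+s c (u zero) 0ℚ ⟨
  c + ((u zero - c) * 1ℚ + 0ℚ)           ≡⟨ cong (λ s → c + ((u zero - c) * 1ℚ + s)) later≡0 ⟨
  c + ((u zero - c) * 1ℚ + ∑ (f ∘ suc))  ≡⟨ cong (c +_) (∑-suc f) ⟨
  c + ∑ f                                ∎
  where
  f : Fin (ℕ.suc n) → ℚ
  f q = Δ c u q * ray q zero
  later≡0 : ∑ (f ∘ suc) ≡ 0ℚ
  later≡0 = sumℚ-*0 (Δ c u ∘ suc) (allFinL n)
telescope {ℕ.suc n} c u (suc p) = begin
  u (suc p)                                            ≡⟨ telescope (u zero) (u ∘ suc) p ⟩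
  u zero + ∑ (λ q → Δ (u zero) (u ∘ suc) q * ray q p) ≡⟨ cong (u zero +_) (∑-cong shifted-term) ⟩
  u zero + ∑ (f ∘ suc)                                 ≡⟨ c+[a-c]*1+s≡a+s c (u zero) _ ⟨
  c + ((u zero - c) * 1ℚ + ∑ (f ∘ suc))                ≡⟨ cong (c +_) (∑-suc f) ⟨
  c + ∑ f                                              ∎
  where
  f : Fin (ℕ.suc n) → ℚ
  f q = Δ c u q * ray q (suc p)
  shifted-term : ∀ q → Δ (u zero) (u ∘ suc) q * ray q p ≡ f (suc q)
  shifted-term q = cong (_* ray q p) (Δ-suc c u q)

combination : ∀ {n} → List (ℚ × Point n) → Point n
combination cs i = sumℚ (map (λ c → proj₁ c * proj₂ c i) cs)

-- Faces of the closed region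

module _ {n : ℕ} (w : SignedPerm n) where

  Tight : Subset n → Point n → Set
  Tight T x = ∀ p → p ∈ T → prev w x p ≡ val w x p

  prev≡shift : ∀ x p → prev w x p ≡ shift 0ℚ (val w x) p
  prev≡shift x zero    = refl
  prev≡shift x (suc p) = refl

  point : (Fin n → ℚ) → Point n
  point u i = ε w (ω w ⟨$⟩ˡ i) · u (ω w ⟨$⟩ˡ i)

  val-point : ∀ u p → val w (point u) p ≡ u p
  val-point u p = begin
    ε w p · (ε w r · u r) ≡⟨ cong (λ r → ε w p · (ε w r · u r)) (inverseˡ (ω w)) ⟩
    ε w p · (ε w p · u p) ≡⟨ ·-involutive (ε w p) (u p) ⟩
    u p                   ∎
    where r = ω w ⟨$⟩ˡ (ω w ⟨$⟩ʳ p)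

  point-val : ∀ x i → point (val w x) i ≡ x i
  point-val x i = begin
    ε w r · (ε w r · x (ω w ⟨$⟩ʳ r)) ≡⟨ ·-involutive (ε w r) _ ⟩
    x (ω w ⟨$⟩ʳ r)                    ≡⟨ cong x (inverseʳ (ω w)) ⟩
    x i                               ∎
    where r = ω w ⟨$⟩ˡ i

  prev-point : ∀ u p → prev w (point u) p ≡ shift 0ℚ u p
  prev-point u zero    = refl
  prev-point u (suc p) = val-point u (inject₁ p)

  point∈Face : ∀ {T} u → (∀ p → shift 0ℚ u p ≤ u p) → (∀ p → p ∈ T → shift 0ℚ u p ≡ u p) →
    Face w T (point u)
  point∈Face u monotone tight =
    (λ p → subst₂ _≤_ (sym (prev-point u p)) (sym (val-point u p)) (monotone p)) ,
    (λ p p∈T → trans (prev-point u p) (trans (tight p p∈T) (sym (val-point u p))))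

  module _ (x : Point n) (cs : List (ℚ × Point n))
           (x≡cs : ∀ i → x i ≡ combination cs i) where

    val-combination : ∀ p → val w x p ≡ sumℚ (map (λ c → proj₁ c * val w (proj₂ c) p) cs)
    val-combination p = trans (cong (ε w p ·_) (x≡cs (ω w ⟨$⟩ʳ p)))
      (sumℚ-· (ε w p) proj₁ (λ c → proj₂ c (ω w ⟨$⟩ʳ p)) cs)

    prev-combination : ∀ p → prev w x p ≡ sumℚ (map (λ c → proj₁ c * prev w (proj₂ c) p) cs)
    prev-combination zero    = sym (sumℚ-*0 proj₁ cs)
    prev-combination (suc p) = val-combination (inject₁ p)

  span⊆tight : ∀ T x → Span (Face w T) x → Tight T x
  span⊆tight T x (cs , faces , x≡cs) p p∈T = begin
    prev w x p                                          ≡⟨ prev-combination x cs x≡cs p ⟩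
    sumℚ (map (λ c → proj₁ c * prev w (proj₂ c) p) cs) ≡⟨ cong sumℚ (map-cong-local tight-terms) ⟩
    sumℚ (map (λ c → proj₁ c * val w (proj₂ c) p) cs)  ≡⟨ val-combination x cs x≡cs p ⟨
    val w x p                                           ∎
    where
    tight-terms : All (λ c → proj₁ c * prev w (proj₂ c) p ≡ proj₁ c * val w (proj₂ c) p) cs
    tight-terms = All.map (λ {c} face → cong (proj₁ c *_) (proj₂ face p p∈T)) faces

  -- For q ∈ T the coefficient of the ray q vanishes on Tight vectors,
  -- and the ray itself is not in the face, so it is replaced by 0.
  faceRay : Subset n → Fin n → Fin n → ℚ
  faceRay T q with q ∈? T
  ... | yes _ = λ _ → 0ℚ
  ... | no  _ = ray q

  faceRay∈Face : ∀ T q → Face w T (point (faceRay T q))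
  faceRay∈Face T q with q ∈? T
  ... | yes _   = point∈Face _ (λ p → ℚ.≤-reflexive (shift-const 0ℚ p)) (λ p _ → shift-const 0ℚ p)
  ... | no  q∉T = point∈Face _ (shift-ray-≤ q) (λ p p∈T → shift-ray-≡ q p λ { refl → q∉T p∈T })

  tight⊆span : ∀ T x → Tight T x → Span (Face w T) x
  tight⊆span T x tight =
    generators , All.map⁺ (All.tabulate λ {q} _ → faceRay∈Face T q) , x≡cs
    where
    u : Fin n → ℚ
    u = val w x

    generators : List (ℚ × Point n)
    generators = map (λ q → Δ 0ℚ u q , point (faceRay T q)) (allFinL n)

    Δ≡0 : ∀ q → q ∈ T → Δ 0ℚ u q ≡ 0ℚ
    Δ≡0 q q∈T = begin
      u q - shift 0ℚ u q ≡⟨ cong (λ t → u q - t) (prev≡shift x q) ⟨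
      u q - prev w x q   ≡⟨ cong (λ t → u q - t) (tight q q∈T) ⟩
      u q - u q          ≡⟨ ℚ.+-inverseʳ (u q) ⟩
      0ℚ                 ∎

    ray≈faceRay : ∀ p q → Δ 0ℚ u q * ray q p ≡ Δ 0ℚ u q * faceRay T q p
    ray≈faceRay p q with q ∈? T
    ... | yes q∈T = begin
      Δ 0ℚ u q * ray q p ≡⟨ cong (_* ray q p) (Δ≡0 q q∈T) ⟩
      0ℚ * ray q p       ≡⟨ ℚ.*-zeroˡ (ray q p) ⟩
      0ℚ                 ≡⟨ ℚ.*-zeroʳ (Δ 0ℚ u q) ⟨
      Δ 0ℚ u q * 0ℚ      ∎
    ... | no  _   = refl

    u≡∑faceRays : ∀ p → u p ≡ ∑ (λ q → Δ 0ℚ u q * faceRay T q p)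
    u≡∑faceRays p = trans (telescope 0ℚ u p) (trans (ℚ.+-identityˡ _) (∑-cong (ray≈faceRay p)))

    x≡cs : ∀ i → x i ≡ combination generators i
    x≡cs i = begin
      x i                                        ≡⟨ point-val x i ⟨
      ε w r · u r                                ≡⟨ cong (ε w r ·_) (u≡∑faceRays r) ⟩
      ε w r · ∑ (λ q → Δ 0ℚ u q * faceRay T q r) ≡⟨ sumℚ-· (ε w r) (Δ 0ℚ u) (λ q → faceRay T q r) (allFinL n) ⟩
      ∑ (λ q → Δ 0ℚ u q * point (faceRay T q) i) ≡⟨ cong sumℚ (map-∘ (allFinL n)) ⟩
      combination generators i                   ∎
      where r = ω w ⟨$⟩ˡ i

  span-face⇔tight : ∀ T x → Span (Face w T) x ⇔ Tight T x
  span-face⇔tight T x = mk⇔ (span⊆tight T x) (tight⊆span T x)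

-- Splitting a word into segments

flipBlock-involutive : ∀ {n} (b : List (Letter n)) → flipBlock (flipBlock b) ≡ b
flipBlock-involutive []            = refl
flipBlock-involutive ((i , s) ∷ b) =
  cong₂ _∷_ (cong (i ,_) (opposite-involutive s)) (flipBlock-involutive b)

normalise-elim : ∀ {n} (P : List (Letter n) → Set) {b} → P b → P (flipBlock b) → P (normalise b)
normalise-elim P {[]}    Pb _ = Pb
normalise-elim P {a ∷ r} Pb Pb̄ with proj₂ (minLetter a r)
... | ⊕ = Pb
... | ⊖ = Pb̄

module _ {n : ℕ} (x : Point n) where

  value : Letter n → ℚ
  value (i , s) = s · x i

  Glued : ℚ → List (Letter n × Bool) → Set
  Glued c []              = ⊤
  Glued c ((l , cut) ∷ L) = (cut ≡ false → c ≡ value l) × Glued (value l) L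

  Constant : List (Letter n) → Set
  Constant b = ∀ i s j t → (i , s) ∈ₗ b → (j , t) ∈ₗ b → s · x i ≡ t · x j

  All≡⇒Constant : ∀ {v b} → All (λ l → value l ≡ v) b → Constant b
  All≡⇒Constant values i s j t m m′ = trans (All.lookup values m) (sym (All.lookup values m′))

  SegmentsConstant : ℚ → List (Letter n) × List (List (Letter n)) → Set
  SegmentsConstant c (z , bs) = All (λ l → value l ≡ c) z × All Constant bs

  glued⇒segmentsConstant : ∀ c L → Glued c L → SegmentsConstant c (segments L)
  glued⇒segmentsConstant c [] _ = [] , []
  glued⇒segmentsConstant c ((l , false) ∷ L) (c≡l , glued) =
    let z , bs = glued⇒segmentsConstant (value l) L glued
    in (sym (c≡l refl) ∷ All.map (λ e → trans e (sym (c≡l refl))) z) , bs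
  glued⇒segmentsConstant c ((l , true) ∷ L) (_ , glued) =
    let z , bs = glued⇒segmentsConstant (value l) L glued
    in [] , All≡⇒Constant (refl ∷ z) ∷ bs

  segmentsConstant⇒glued : ∀ c L → SegmentsConstant c (segments L) → Glued c L
  segmentsConstant⇒glued c [] _ = tt
  segmentsConstant⇒glued c ((l , false) ∷ L) (l≡c ∷ z , bs) =
    (λ _ → sym l≡c) , segmentsConstant⇒glued (value l) L (All.map (λ e → trans e (sym l≡c)) z , bs)
  segmentsConstant⇒glued c ((l , true) ∷ L) (_ , b ∷ bs) =
    (λ ()) , segmentsConstant⇒glued (value l) L (rest≡l , bs)
    where
    rest≡l : All (λ l′ → value l′ ≡ value l) (proj₁ (segments L))
    rest≡l = All.tabulate λ m → b _ _ _ _ (there m) (here refl)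

  glued⇔segmentsConstant : ∀ c L → Glued c L ⇔ SegmentsConstant c (segments L)
  glued⇔segmentsConstant c L = mk⇔ (glued⇒segmentsConstant c L) (segmentsConstant⇒glued c L)

  GluedAt : ∀ {m} → ℚ → (Fin m → Letter n × Bool) → Set
  GluedAt c h = ∀ p → proj₂ (h p) ≡ false → shift c (value ∘ proj₁ ∘ h) p ≡ value (proj₁ (h p))

  glued⇒gluedAt : ∀ {m} c (h : Fin m → Letter n × Bool) → Glued c (map h (allFinL m)) → GluedAt c h
  glued⇒gluedAt c h (first , _) zero uncut = first uncut
  glued⇒gluedAt {ℕ.suc m} c h (_ , rest) (suc p) uncut = begin
    shift c v (suc p)          ≡⟨ shift-suc c v p ⟨
    shift (v zero) (v ∘ suc) p ≡⟨ glued⇒gluedAt (v zero) (h ∘ suc) rest′ p uncut ⟩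
    v (suc p)                  ∎
    where
    v : Fin (ℕ.suc m) → ℚ
    v = value ∘ proj₁ ∘ h
    rest′ : Glued (v zero) (map (h ∘ suc) (allFinL m))
    rest′ = subst (Glued (v zero)) (sym (map-∘ (allFinL m))) rest

  gluedAt⇒glued : ∀ {m} c (h : Fin m → Letter n × Bool) → GluedAt c h → Glued c (map h (allFinL m))
  gluedAt⇒glued {ℕ.zero}  c h _     = tt
  gluedAt⇒glued {ℕ.suc m} c h glued =
    glued zero , subst (Glued _) (map-∘ (allFinL m)) (gluedAt⇒glued _ (h ∘ suc) glued-suc)
    where
    glued-suc : GluedAt (value (proj₁ (h zero))) (h ∘ suc)
    glued-suc p uncut = trans (shift-suc c (value ∘ proj₁ ∘ h) p) (glued (suc p) uncut)

  glued⇔gluedAt : ∀ {m} c (h : Fin m → Letter n × Bool) → Glued c (map h (allFinL m)) ⇔ GluedAt c h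
  glued⇔gluedAt c h = mk⇔ (glued⇒gluedAt c h) (gluedAt⇒glued c h)

  flip-constant : ∀ b → Constant b → Constant (flipBlock b)
  flip-constant b const _ _ _ _ m m′ with ∈-map⁻ _ m | ∈-map⁻ _ m′
  ... | (i , s) , m₀ , refl | (j , t) , m₀′ , refl = begin
    opposite s · x i ≡⟨ opposite-· s (x i) ⟩
    - (s · x i)      ≡⟨ cong -_ (const i s j t m₀ m₀′) ⟩
    - (t · x j)      ≡⟨ sym (opposite-· t (x j)) ⟩
    opposite t · x j ∎

  constant-normalise : ∀ b → Constant (normalise b) ⇔ Constant b
  constant-normalise b = normalise-elim (λ b′ → Constant b′ ⇔ Constant b) (⇔-id _)
    (mk⇔ (subst Constant (flipBlock-involutive b) ∘ flip-constant (flipBlock b)) (flip-constant b))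


module _ {n : ℕ} (w : SignedPerm n) (S : Subset n) where

  letterAt : Fin n → Letter n × Bool
  letterAt p = ((ω w ⟨$⟩ʳ p) , ε w p) , Vec.lookup S p

  word : List (Letter n × Bool)
  word = map letterAt (allFinL n)

  ℓ-split⇔segmentsConstant : ∀ x → ℓ (split w S) x ⇔ SegmentsConstant x 0ℚ (segments word)
  ℓ-split⇔segmentsConstant x =
      ⇔-trans (∀∈-map⇔All _ proj₁ z) (All-cong λ l → ⇔-sym (·≡0⇔≡0 (proj₂ l) (x (proj₁ l))))
    ×-⇔ ⇔-trans (∀∈-map⇔All _ normalise bs) (All-cong (constant-normalise x))
    where
    z  = proj₁ (segments word)
    bs = proj₂ (segments word)

  tight⇔ℓ-split : ∀ {T} → (∀ p → p ∈ T ⇔ p ∉ S) → ∀ x → Tight w T x ⇔ ℓ (split w S) x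
  tight⇔ℓ-split {T} complement x =
    ⇔-trans tight⇔gluedAt (⇔-trans (⇔-sym (glued⇔gluedAt x 0ℚ letterAt))
      (⇔-trans (glued⇔segmentsConstant x 0ℚ word) (⇔-sym (ℓ-split⇔segmentsConstant x))))
    where
    uncut⇔∈T : ∀ p → Vec.lookup S p ≡ false ⇔ p ∈ T
    uncut⇔∈T p = ⇔-trans (lookup≡false⇔∉ S p) (⇔-sym (complement p))

    tight⇔gluedAt : Tight w T x ⇔ GluedAt x 0ℚ letterAt
    tight⇔gluedAt = mk⇔
      (λ tight p uncut → trans (sym (prev≡shift w x p)) (tight p (to (uncut⇔∈T p) uncut)))
      (λ glued p p∈T → trans (prev≡shift w x p) (glued p (from (uncut⇔∈T p) p∈T)))

span-face≐ℓ-split : ∀ {n} (w : SignedPerm n) {T S} → (∀ p → p ∈ T ⇔ p ∉ S) →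
  SameSpace (Span (Face w T)) (ℓ (split w S))
span-face≐ℓ-split w {T} {S} complement x = to span⇔ℓ , from span⇔ℓ
  where span⇔ℓ = ⇔-trans (span-face⇔tight w T x) (tight⇔ℓ-split w S complement x)

proposition7p1 : ∀ (n : ℕ) (w : SignedPerm n) →
    (∀ (T : Subset n) → ∃ λ (S : Subset n) →
        SameSpace (Span (Face w T)) (ℓ (split w S))) ×
    (∀ (S : Subset n) → ∃ λ (T : Subset n) →
        SameSpace (Span (Face w T)) (ℓ (split w S)))
proposition7p1 n w =
  (λ T → ∁ T , span-face≐ℓ-split w (λ p → mk⇔ x∈p⇒x∉∁p x∉∁p⇒x∈p)) ,
  (λ S → ∁ S , span-face≐ℓ-split w (λ p → mk⇔ x∈∁p⇒x∉p x∉p⇒x∈∁p))
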